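{- Let $\mathcal F\subset 2^{[n]}$ have non-empty support and let $a$ be the number of atoms of $\mathcal F$. Then $\mathcal F^a$ contains an atom of $\mathcal F$.
   Context: $\mathcal F^r$ denotes the family of all intersections $A_1\cap\cdots\cap A_r$ of $r$ not necessarily distinct members of $\mathcal F$. The support of $\mathcal F$ is $\bigcup_{F\in\mathcal F}F$. An atom of $\mathcal F$ is a non-empty subset $A$ of the support of $\mathcal F$ such that (i) for every $F\in\mathcal F$, either $A\subset F$ or $A\cap F=\varnothing$, and (ii) for every $B\supsetneq A$ there is $F\in\mathcal F$ with $\varnothing\subsetneq F\cap B\subsetneq B$. -}

module Defs where

open import Data.Nat using (ℕ)
open import Data.Fin using (Fin)
open import Data.Fin.Subset using (Subset; _∈_; _⊆_; _⊂_; _∩_; ⊤; Nonempty; Empty)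
open import Data.Vec using (Vec; foldr′)
open import Data.Vec.Relation.Unary.All using (All)
open import Data.Product using (Σ; ∃; _×_)
open import Data.Sum using (_⊎_)
open import Relation.Binary.PropositionalEquality using (_≡_)

Family : ℕ → Set₁
Family n = Subset n → Set

InSupport : ∀ {n} → Family n → Fin n → Set
InSupport 𝓕 x = Σ (Subset _) λ F → 𝓕 F × x ∈ F

SubsetOfSupport : ∀ {n} → Family n → Subset n → Set
SubsetOfSupport 𝓕 A = ∀ x → x ∈ A → InSupport 𝓕 x

NonemptySupport : ∀ {n} → Family n → Set
NonemptySupport 𝓕 = ∃ λ x → InSupport 𝓕 x

IsAtom : ∀ {n} → Family n → Subset n → Set
IsAtom {n} 𝓕 A =
  Nonempty A × SubsetOfSupport 𝓕 A
  × (∀ F → 𝓕 F → A ⊆ F ⊎ Empty (A ∩ F))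
  × (∀ (B : Subset n) → A ⊂ B →
       Σ (Subset n) λ F → 𝓕 F × Nonempty (F ∩ B) × (F ∩ B) ⊂ B)

-- 𝓕^r : intersections A₁ ∩ ⋯ ∩ A_r of r (not necessarily distinct) members of 𝓕
-- (intersection of a vector, with the empty intersection taken as [n]).
Power : ∀ {n} → Family n → ℕ → Family n
Power {n} 𝓕 r A = Σ (Vec (Subset n) r) λ v → All 𝓕 v × A ≡ foldr′ _∩_ ⊤ v

{-# OPTIONS --safe #-}
-- Distinct atoms are separated by members of 𝓕 (maximality applied to A ∪ B); collect one
-- separating member for each pair of distinct atoms. Among the atoms, order B ≼ A when B lies
-- in every collected member containing A, and take a ≼-minimal atom A. Minimality gives, for
-- each atom B ≠ A, a member containing A but not B, hence disjoint from B. Choosing such a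
-- member for every atom (any member containing A for A itself) gives a members whose
-- intersection contains A and meets no other atom; as the atoms cover the support, it is A.
-- That a point lies in an atom (its class under indistinguishability by 𝓕) is constructively
-- available only under a double negation, which is harmless since lying in a listed atom is
-- decidable.
module Submission where

open import Defs
open import Level using (Level)
open import Data.Nat using (ℕ; zero; suc)
open import Data.Bool using () renaming (_≟_ to _≟ᵇ_)
open import Data.Fin using (Fin; zero; suc)
open import Data.Fin.Properties using (any?; sequence)
open import Data.Fin.Subset using (Subset; _⊆_; _⊈_; _⊂_; _∩_; _∪_; ⊤; Nonempty; Empty)
  renaming (_∈_ to _∈ₛ_; _∉_ to _∉ₛ_)
open import Data.Fin.Subset.Properties
  using (_∈?_; _⊆?_; ⊆-antisym; ∈⊤; p⊆p∪q; q⊆p∪q; p∩q⊆q; x∈p∩q⁺; x∈p∩q⁻; x∈p∪q⁻)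
open import Data.Vec using (tabulate; foldr′)
open import Data.Vec.Properties using (≡-dec; lookup∘tabulate; []=⇒lookup; lookup⇒[]=)
open import Data.Vec.Relation.Unary.All.Properties using (tabulate⁺)
open import Data.List using (List; []; _∷_; length; lookup; cartesianProduct)
open import Data.List.Membership.Propositional using (_∈_; find; lose)
open import Data.List.Membership.Propositional.Properties
  using (∈-lookup; ∈-cartesianProduct⁺; ∈-cartesianProduct⁻)
open import Data.List.Relation.Unary.Any as Any using (Any; here; there; satisfied)
open import Data.List.Relation.Unary.Any.Properties using (lookup-index)
open import Data.List.Relation.Unary.All using (All; all?; lookupAny; zip; zipWith)
open import Data.List.Relation.Unary.All.Properties using (¬All⇒Any¬)
open import Data.List.Relation.Unary.Unique.Propositional using (Unique)
open import Data.Product using (Σ; ∃; _×_; _,_; proj₁; proj₂; uncurry)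
open import Data.Sum using (_⊎_; inj₁; inj₂; [_,_]′; swap)
open import Data.Empty using (⊥-elim)
open import Effect.Monad using (RawMonad)
open import Function using (_∘_; _∘′_; id; const)
open import Function.Bundles using (_⇔_; Equivalence)
open import Relation.Binary using (Rel; Decidable; DecidableEquality; Transitive)
open import Relation.Binary.PropositionalEquality using (_≡_; _≢_; refl; sym; trans; subst)
open import Relation.Nullary using (¬_; Dec; yes; no; does)
open import Relation.Nullary.Decidable
  using (decidable-stable; dec-true; dec-false; _×-dec_; _→-dec_; ¬?)
open import Relation.Nullary.Negation using (contradiction; ¬¬-Monad; ¬¬-map; Stable; DoubleNegation)
open import Relation.Unary using (Pred) renaming (Decidable to Decidable₁)

private
  variable
    a b ℓ : Level
    X : Set a
    n : ℕ
    A B F : Subset n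
    x y : Fin n

¬¬-∀⊎∃¬ : {P : Pred X ℓ} → (∀ x → Stable (P x)) →
  DoubleNegation ((∀ x → P x) ⊎ ∃ λ x → ¬ P x)
¬¬-∀⊎∃¬ stable k = k (inj₁ λ x → stable x λ ¬px → k (inj₂ (x , ¬px)))

Minimal : Rel X ℓ → List X → X → Set _
Minimal R xs m = ∀ {y} → y ∈ xs → R y m → R m y

minimal : {R : Rel X ℓ} → Decidable R → Transitive R →
  ∀ {x xs} → x ∈ xs → ∃ λ m → m ∈ xs × Minimal R xs m
minimal R? R-trans {xs = y ∷ []} _ = y , here refl , λ { (here refl) → id }
minimal R? R-trans {xs = y ∷ z ∷ zs} _ with minimal R? R-trans {xs = z ∷ zs} (here refl)
... | m , m∈ , m-min with R? y m
...   | yes yRm = y , here refl , λ where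
          (here refl) → id
          (there w∈) wRy → R-trans yRm (m-min w∈ (R-trans wRy yRm))
...   | no ¬yRm = m , there m∈ , λ where
          (here refl) yRm → contradiction yRm ¬yRm
          (there w∈) → m-min w∈

choose-witnesses : {Y : Set b} {P : Pred X ℓ} {Q : X → Y → Set ℓ} →
  Decidable₁ P → (xs : List X) → (∀ {x} → x ∈ xs → P x → ∃ (Q x)) →
  ∃ λ (ys : List Y) → ∀ {x} → x ∈ xs → P x → Any (Q x) ys
choose-witnesses P? [] _ = [] , λ ()
choose-witnesses P? (x ∷ xs) witness
  with choose-witnesses P? xs (λ x∈ → witness (there x∈)) | P? x
... | ys , ys-ok | no ¬px = ys , λ where
        (here refl) px → contradiction px ¬px
        (there x∈) → ys-ok x∈
... | ys , ys-ok | yes px = proj₁ (witness (here refl) px) ∷ ys , λ where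
        (here refl) _ → here (proj₂ (witness (here refl) px))
        (there x∈) → there ∘ ys-ok x∈

_≟_ : DecidableEquality (Subset n)
_≟_ = ≡-dec _≟ᵇ_

⊈⇒∃∈∉ : A ⊈ B → ∃ λ x → x ∈ₛ A × x ∉ₛ B
⊈⇒∃∈∉ {A = A} {B} A⊈B = decidable-stable (any? λ x → x ∈? A ×-dec ¬? (x ∈? B))
  λ ∄ → A⊈B λ {x} x∈A → decidable-stable (x ∈? B) λ x∉B → ∄ (x , x∈A , x∉B)

fromDec : {P : Pred (Fin n) ℓ} → Decidable₁ P → Subset n
fromDec P? = tabulate (does ∘ P?)

module _ {P : Pred (Fin n) ℓ} (P? : Decidable₁ P) where

  ∈-fromDec⁺ : P x → x ∈ₛ fromDec P?
  ∈-fromDec⁺ {x} px = lookup⇒[]= x _ (trans (lookup∘tabulate _ x) (dec-true (P? x) px))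

  ∈-fromDec⁻ : x ∈ₛ fromDec P? → P x
  ∈-fromDec⁻ {x} x∈ = decidable-stable (P? x) λ ¬px →
    contradiction (trans (sym ([]=⇒lookup x∈)) (trans (lookup∘tabulate _ x) (dec-false (P? x) ¬px)))
                  λ ()

∈-⋂-tabulate⁺ : ∀ {r} (f : Fin r → Subset n) → (∀ i → x ∈ₛ f i) → x ∈ₛ foldr′ _∩_ ⊤ (tabulate f)
∈-⋂-tabulate⁺ {r = zero} f _ = ∈⊤
∈-⋂-tabulate⁺ {r = suc r} f x∈f = x∈p∩q⁺ (x∈f zero , ∈-⋂-tabulate⁺ (f ∘ suc) (x∈f ∘ suc))

∈-⋂-tabulate⁻ : ∀ {r} (f : Fin r → Subset n) → x ∈ₛ foldr′ _∩_ ⊤ (tabulate f) → ∀ i → x ∈ₛ f i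
∈-⋂-tabulate⁻ {r = suc r} f x∈⋂ zero = proj₁ (x∈p∩q⁻ _ _ x∈⋂)
∈-⋂-tabulate⁻ {r = suc r} f x∈⋂ (suc i) = ∈-⋂-tabulate⁻ (f ∘ suc) (proj₂ (x∈p∩q⁻ _ _ x∈⋂)) i

Cuts : Subset n → Subset n → Set
Cuts F B = Nonempty (F ∩ B) × F ∩ B ⊂ B

∈∉⇒Cuts : x ∈ₛ F → y ∉ₛ F → x ∈ₛ B → y ∈ₛ B → Cuts F B
∈∉⇒Cuts {F = F} {B = B} x∈F y∉F x∈B y∈B =
  (_ , x∈p∩q⁺ (x∈F , x∈B)) , p∩q⊆q F B , _ , y∈B , y∉F ∘ proj₁ ∘ x∈p∩q⁻ F B

Cuts⇒∈∉ : Cuts F B → ∃ λ y → ∃ λ z → (y ∈ₛ F × y ∈ₛ B) × (z ∉ₛ F × z ∈ₛ B)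
Cuts⇒∈∉ {F = F} {B = B} ((y , y∈F∩B) , _ , z , z∈B , z∉F∩B) =
  y , z , x∈p∩q⁻ F B y∈F∩B , (λ z∈F → z∉F∩B (x∈p∩q⁺ (z∈F , z∈B))) , z∈B

Agree : Subset n → Fin n → Fin n → Set
Agree F x y = (x ∈ₛ F → y ∈ₛ F) × (y ∈ₛ F → x ∈ₛ F)

agree? : ∀ F (x y : Fin n) → Dec (Agree F x y)
agree? F x y = (x ∈? F →-dec y ∈? F) ×-dec (y ∈? F →-dec x ∈? F)

¬Agree⇒Cuts : ¬ Agree F x y → x ∈ₛ B → y ∈ₛ B → Cuts F B
¬Agree⇒Cuts {F = F} {x} {y} ¬agree x∈B y∈B with x ∈? F | y ∈? F
... | yes x∈F | no y∉F = ∈∉⇒Cuts x∈F y∉F x∈B y∈B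
... | no x∉F | yes y∈F = ∈∉⇒Cuts y∈F x∉F y∈B x∈B
... | yes x∈F | yes y∈F = contradiction (const y∈F , const x∈F) ¬agree
... | no x∉F | no y∉F =
  contradiction ((λ x∈F → contradiction x∈F x∉F) , (λ y∈F → contradiction y∈F y∉F)) ¬agree

Separates : Subset n → Subset n → Subset n → Set
Separates A B F = (A ⊆ F × B ⊈ F) ⊎ (B ⊆ F × A ⊈ F)

¬Separates : (A ⊆ F → B ⊆ F) → (B ⊆ F → A ⊆ F) → ¬ Separates A B F
¬Separates A⊆→B⊆ _ (inj₁ (A⊆F , B⊈F)) = B⊈F (A⊆→B⊆ A⊆F)
¬Separates _ B⊆→A⊆ (inj₂ (B⊆F , A⊈F)) = A⊈F (B⊆→A⊆ B⊆F)

Isolates : Subset n → Subset n → Subset n → Set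
Isolates A B F = A ⊆ F × (B ⊆ F → B ≡ A)

module _ {n} (𝓕 : Family n) where

  Member : Set
  Member = Σ (Subset n) 𝓕

  tabulate-power : ∀ {r} (f : Fin r → Member) → (∀ i → A ⊆ proj₁ (f i)) →
    (∀ {x} → (∀ i → x ∈ₛ proj₁ (f i)) → x ∈ₛ A) → Power 𝓕 r A
  tabulate-power f A⊆fᵢ ⋂⊆A = tabulate (proj₁ ∘ f) , tabulate⁺ (proj₂ ∘ f) ,
    ⊆-antisym (λ x∈A → ∈-⋂-tabulate⁺ _ λ i → A⊆fᵢ i x∈A) (⋂⊆A ∘ ∈-⋂-tabulate⁻ _)

  atom-meets⇒⊆ : IsAtom 𝓕 A → 𝓕 F → x ∈ₛ A → x ∈ₛ F → A ⊆ F
  atom-meets⇒⊆ (_ , _ , ⊆-or-disjoint , _) 𝓕F x∈A x∈F with ⊆-or-disjoint _ 𝓕F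
  ... | inj₁ A⊆F = A⊆F
  ... | inj₂ A∩F≡∅ = contradiction (_ , x∈p∩q⁺ (x∈A , x∈F)) A∩F≡∅

  atom⊆member : IsAtom 𝓕 A → ∃ λ F → 𝓕 F × A ⊆ F
  atom⊆member a@((x , x∈A) , ⊆support , _) =
    let F , 𝓕F , x∈F = ⊆support x x∈A in F , 𝓕F , atom-meets⇒⊆ a 𝓕F x∈A x∈F

  Cuts-∪⇒Separates : IsAtom 𝓕 A → IsAtom 𝓕 B → 𝓕 F → Cuts F (A ∪ B) → Separates A B F
  Cuts-∪⇒Separates {A} {B} a b 𝓕F cuts with Cuts⇒∈∉ cuts
  ... | _ , _ , (y∈F , y∈A∪B) , (z∉F , z∈A∪B) with x∈p∪q⁻ A B y∈A∪B | x∈p∪q⁻ A B z∈A∪B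
  ...   | inj₁ y∈A | inj₁ z∈A = contradiction (atom-meets⇒⊆ a 𝓕F y∈A y∈F z∈A) z∉F
  ...   | inj₁ y∈A | inj₂ z∈B = inj₁ (atom-meets⇒⊆ a 𝓕F y∈A y∈F , λ B⊆F → z∉F (B⊆F z∈B))
  ...   | inj₂ y∈B | inj₁ z∈A = inj₂ (atom-meets⇒⊆ b 𝓕F y∈B y∈F , λ A⊆F → z∉F (A⊆F z∈A))
  ...   | inj₂ y∈B | inj₂ z∈B = contradiction (atom-meets⇒⊆ b 𝓕F y∈B y∈F z∈B) z∉F

  separated-by-point : IsAtom 𝓕 A → IsAtom 𝓕 B → x ∈ₛ B → x ∉ₛ A →
    ∃ λ F → 𝓕 F × Separates A B F
  separated-by-point {A} {B} a@(_ , _ , _ , maximal) b x∈B x∉A =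
    let F , 𝓕F , cuts = maximal (A ∪ B) (p⊆p∪q B , _ , q⊆p∪q A B x∈B , x∉A)
    in F , 𝓕F , Cuts-∪⇒Separates a b 𝓕F cuts

  atoms-separated : IsAtom 𝓕 A → IsAtom 𝓕 B → A ≢ B → ∃ λ F → 𝓕 F × Separates A B F
  atoms-separated {A} {B} a b A≢B with B ⊆? A | A ⊆? B
  ... | no B⊈A | _ = let _ , x∈B , x∉A = ⊈⇒∃∈∉ B⊈A in separated-by-point a b x∈B x∉A
  ... | yes _ | no A⊈B =
    let _ , x∈A , x∉B = ⊈⇒∃∈∉ A⊈B
        F , 𝓕F , separates = separated-by-point b a x∈A x∉B
    in F , 𝓕F , swap separates
  ... | yes B⊆A | yes A⊆B = contradiction (⊆-antisym A⊆B B⊆A) A≢B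

  _≈_ : Fin n → Fin n → Set
  x ≈ y = ∀ (M : Member) → Agree (proj₁ M) x y

  Classification : Fin n → Set
  Classification x = ∀ y → x ≈ y ⊎ ∃ λ (M : Member) → ¬ Agree (proj₁ M) x y

  -- x ≈ y is not decidable (𝓕 is an arbitrary predicate); finiteness of Fin n lets us decide
  -- it for all y at once under a double negation.
  ¬¬-classification : ∀ x → DoubleNegation (Classification x)
  ¬¬-classification x = sequence (RawMonad.rawApplicative ¬¬-Monad) λ y →
    ¬¬-∀⊎∃¬ λ M → decidable-stable (agree? (proj₁ M) x y)

  module ClassOf {x} (classify : Classification x) where

    x≈?_ : ∀ y → Dec (x ≈ y)
    x≈? y = [ yes , (λ (M , ¬agree) → no λ x≈y → ¬agree (x≈y M)) ]′ (classify y)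

    class : Subset n
    class = fromDec x≈?_

    x∈class : x ∈ₛ class
    x∈class = ∈-fromDec⁺ x≈?_ λ _ → id , id

    class-isAtom : InSupport 𝓕 x → IsAtom 𝓕 class
    class-isAtom (F₀ , 𝓕F₀ , x∈F₀) = (x , x∈class) , ⊆support , ⊆-or-disjoint , maximal
      where
      ⊆support : SubsetOfSupport 𝓕 class
      ⊆support y y∈ = F₀ , 𝓕F₀ , proj₁ (∈-fromDec⁻ x≈?_ y∈ (F₀ , 𝓕F₀)) x∈F₀

      ⊆-or-disjoint : ∀ F → 𝓕 F → class ⊆ F ⊎ Empty (class ∩ F)
      ⊆-or-disjoint F 𝓕F with x ∈? F
      ... | yes x∈F = inj₁ λ y∈ → proj₁ (∈-fromDec⁻ x≈?_ y∈ (F , 𝓕F)) x∈F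
      ... | no x∉F = inj₂ λ (y , y∈class∩F) →
        let y∈class , y∈F = x∈p∩q⁻ class F y∈class∩F
        in x∉F (proj₂ (∈-fromDec⁻ x≈?_ y∈class (F , 𝓕F)) y∈F)

      maximal : ∀ B → class ⊂ B → ∃ λ F → 𝓕 F × Cuts F B
      maximal B (class⊆B , y , y∈B , y∉class) with classify y
      ... | inj₁ x≈y = contradiction (∈-fromDec⁺ x≈?_ x≈y) y∉class
      ... | inj₂ ((F , 𝓕F) , ¬agree) = F , 𝓕F , ¬Agree⇒Cuts ¬agree (class⊆B x∈class) y∈B

  ¬¬-atom-containing : InSupport 𝓕 x → DoubleNegation (∃ λ A → IsAtom 𝓕 A × x ∈ₛ A)
  ¬¬-atom-containing {x} x∈⋃𝓕 = ¬¬-map atom-of (¬¬-classification x)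
    where
    atom-of : Classification x → ∃ λ A → IsAtom 𝓕 A × x ∈ₛ A
    atom-of classify = class , class-isAtom x∈⋃𝓕 , x∈class
      where open ClassOf classify

  _≼⟨_⟩_ : Subset n → List Member → Subset n → Set
  B ≼⟨ ws ⟩ A = All (λ M → A ⊆ proj₁ M → B ⊆ proj₁ M) ws

  ≼? : ∀ ws → Decidable (_≼⟨ ws ⟩_)
  ≼? ws B A = all? (λ M → A ⊆? proj₁ M →-dec B ⊆? proj₁ M) ws

  ≼-trans : ∀ ws → Transitive (_≼⟨ ws ⟩_)
  ≼-trans ws B≼A A≼C = zipWith (uncurry _∘′_) (B≼A , A≼C)

  ¬≼⇒avoiding-member : ∀ {ws} → ¬ B ≼⟨ ws ⟩ A → ∃ λ (M : Member) → A ⊆ proj₁ M × B ⊈ proj₁ M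
  ¬≼⇒avoiding-member {B} {A} {ws} ¬B≼A =
    let M , ¬[A⊆→B⊆] = satisfied (¬All⇒Any¬ (λ M → A ⊆? proj₁ M →-dec B ⊆? proj₁ M) ws ¬B≼A)
    in M , decidable-stable (A ⊆? proj₁ M) (λ A⊈M → ¬[A⊆→B⊆] λ A⊆M → ⊥-elim (A⊈M A⊆M))
         , ¬[A⊆→B⊆] ∘ const

  ≼-separated-asym : ∀ {ws} → Any (Separates A B ∘ proj₁) ws → B ≼⟨ ws ⟩ A → ¬ A ≼⟨ ws ⟩ B
  ≼-separated-asym separated B≼A A≼B =
    let (A⊆→B⊆ , B⊆→A⊆) , separates = lookupAny (zip (B≼A , A≼B)) separated
    in ¬Separates A⊆→B⊆ B⊆→A⊆ separates

  module Listing (atoms : List (Subset n)) (atoms⇔ : ∀ A → A ∈ atoms ⇔ IsAtom 𝓕 A) where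

    listed⇒atom : A ∈ atoms → IsAtom 𝓕 A
    listed⇒atom = Equivalence.to (atoms⇔ _)

    support⊆listed-atoms : InSupport 𝓕 x → Any (x ∈ₛ_) atoms
    support⊆listed-atoms {x} x∈⋃𝓕 = decidable-stable (Any.any? (x ∈?_) atoms) (¬¬-map
      (λ (A , a , x∈A) → lose (Equivalence.from (atoms⇔ A) a) x∈A) (¬¬-atom-containing x∈⋃𝓕))

    Separating : List Member → Set
    Separating ws = ∀ {A B} → A ∈ atoms → B ∈ atoms → A ≢ B → Any (Separates A B ∘ proj₁) ws

    separating-list : ∃ Separating
    separating-list =
      let ws , separating = choose-witnesses (λ (A , B) → ¬? (A ≟ B))
                              (cartesianProduct atoms atoms) separator
      in ws , λ A∈ B∈ → separating (∈-cartesianProduct⁺ A∈ B∈)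
      where
      separator : ∀ {AB} → AB ∈ cartesianProduct atoms atoms → proj₁ AB ≢ proj₂ AB →
        ∃ λ (M : Member) → Separates (proj₁ AB) (proj₂ AB) (proj₁ M)
      separator AB∈ A≢B =
        let A∈ , B∈ = ∈-cartesianProduct⁻ atoms atoms AB∈
            F , 𝓕F , separates = atoms-separated (listed⇒atom A∈) (listed⇒atom B∈) A≢B
        in (F , 𝓕F) , separates

    Isolated : Subset n → Set
    Isolated A = ∀ {B} → B ∈ atoms → ∃ λ (M : Member) → Isolates A B (proj₁ M)

    minimal⇒isolated : ∀ {ws} → Separating ws → A ∈ atoms → Minimal (_≼⟨ ws ⟩_) atoms A →
      Isolated A
    minimal⇒isolated {A} ws-separating A∈ A-minimal {B} B∈ with B ≟ A
    ... | yes refl = let F , 𝓕F , A⊆F = atom⊆member (listed⇒atom A∈) in (F , 𝓕F) , A⊆F , const refl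
    ... | no B≢A =
      let separated = ws-separating A∈ B∈ (B≢A ∘ sym)
          M , A⊆M , B⊈M = ¬≼⇒avoiding-member λ B≼A →
                            ≼-separated-asym separated B≼A (A-minimal B∈ B≼A)
      in M , A⊆M , λ B⊆M → ⊥-elim (B⊈M B⊆M)

    isolated-atom : B ∈ atoms → ∃ λ A → A ∈ atoms × Isolated A
    isolated-atom B∈ =
      let ws , ws-separating = separating-list
          A , A∈ , A-minimal = minimal (≼? ws) (≼-trans ws) B∈
      in A , A∈ , minimal⇒isolated ws-separating A∈ A-minimal

    isolated-power : A ∈ atoms → Isolated A → Power 𝓕 (length atoms) A
    isolated-power {A} A∈ isolated = tabulate-power Fᵢ (proj₁ ∘ isolatesᵢ) ⋂⊆A
      where
      Fᵢ : Fin (length atoms) → Member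
      Fᵢ i = proj₁ (isolated (∈-lookup i))

      isolatesᵢ : ∀ i → Isolates A (lookup atoms i) (proj₁ (Fᵢ i))
      isolatesᵢ i = proj₂ (isolated (∈-lookup i))

      ⋂⊆A : ∀ {x} → (∀ i → x ∈ₛ proj₁ (Fᵢ i)) → x ∈ₛ A
      ⋂⊆A {x} x∈Fᵢ =
        let i₀ = Any.index A∈
            x∈atoms = support⊆listed-atoms (_ , proj₂ (Fᵢ i₀) , x∈Fᵢ i₀)
            j = Any.index x∈atoms
            x∈Bⱼ = lookup-index x∈atoms
            Bⱼ⊆Fⱼ = atom-meets⇒⊆ (listed⇒atom (∈-lookup j)) (proj₂ (Fᵢ j)) x∈Bⱼ (x∈Fᵢ j)
        in subst (x ∈ₛ_) (proj₂ (isolatesᵢ j) Bⱼ⊆Fⱼ) x∈Bⱼ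

proposition4p3 : ∀ {n} (𝓕 : Family n) → NonemptySupport 𝓕 →
    (atoms : List (Subset n)) → Unique atoms → (∀ A → (A ∈ atoms) ⇔ IsAtom 𝓕 A) →
    Σ (Subset n) λ A → IsAtom 𝓕 A × Power 𝓕 (length atoms) A
proposition4p3 𝓕 (_ , x∈⋃𝓕) atoms _ atoms⇔ =
  let open Listing 𝓕 atoms atoms⇔
      _ , B∈ , _ = find (support⊆listed-atoms x∈⋃𝓕)
      A , A∈ , isolated = isolated-atom B∈
  in A , listed⇒atom A∈ , isolated-power A∈ isolated
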